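{- In the setting described in the context, let $\{e_1,e_2,e_3\}$ be the three edges of an $AC_6$ in $H$ which has clauses in $\phi_1$, and let $e$ be an edge of $H$ such that $(\ell_e\vee\ell_{e_1})$ is a clause of $\phi_2''$. If $\ell_e\ne\overline{\ell_{e_1}}$, then $\phi_2''$ also contains the clause $(\ell_e\vee\overline{\ell_{e_2}})$ or the clause $(\ell_e\vee\overline{\ell_{e_3}})$.
   Context: Let $G$ be a cocomparability graph with $n$ vertices and $P$ a (strict) partial order whose comparability graph is $\overline{G}$; ground set $U=\{u_1,\dots,u_n\}$, and $V=\{v_1,\dots,v_n\}$ disjoint. Let $\widetilde{E}=\{u_iv_j: u_i<_Pu_j\text{ does not hold}\}$, $E_0=\{u_iv_i:1\le i\le n\}$, and let $H$ be the graph on $U\cup V$ with edge set $E_H=\widetilde{E}\cup\{vv':v,v'\in V,v\ne v'\}$. Alternating cycles: in a graph $(W,E)$, vertices $w_1,\dots,w_{2k}$, $k\ge2$ (not necessarily distinct, but $w_i\ne w_{i+1}$, indices mod $2k$) build an $AC_{2k}$ in $F\subseteq E$ if $w_iw_{i+1}\in F$ for even $i$ and $w_iw_{i+1}\notin E$ for odd $i$; its edges are the $w_iw_{i+1}$, $i$ even. Edges $e_1,e_2$ are in conflict if one can write $e_1=ab$, $e_2=cd$ with $a,b,c,d$ distinct and $ad,bc\notin E$; an edge of $H$ is committed if it is in conflict with some edge of $H$, otherwise uncommitted. The conflict graph $H^*$ has vertex set $E_H$, two edges adjacent iff in conflict in $H$. Assume $H^*$ is bipartite, fix a proper 2-colouring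 $\chi_0$ (red/blue) of $H^*$, let $C_1,\dots,C_k$ be its connected components with a boolean variable $x_i$ for $C_i$; for an edge $e$ in $C_i$, $\ell_e=x_i$ if red in $\chi_0$ and $\ell_e=\overline{x_i}$ if blue. $\phi_1$ is the conjunction, over all triples $\{e,e',e''\}$ of edges of $H$ that are the three edges of some $AC_6$ in $E_H$ and such that no two of $\ell_e,\ell_{e'},\ell_{e''}$ are negations of each other, of the clauses $(\ell_e\vee\ell_{e'}\vee\ell_{e''})$ and $(\overline{\ell_e}\vee\overline{\ell_{e'}}\vee\overline{\ell_{e''}})$; an $AC_6$ "has clauses in $\phi_1$" if its edge triple satisfies this negation condition. $\phi_2$: with $E'=E_H\setminus E_0$, for all indices $i,j$ (possibly equal) with $u_iv_j\notin E'$ and all $t$ with $u_iv_t,u_tv_j\in E'$, $\phi_2$ contains the clause $(\ell_{u_iv_t}\vee\ell_{u_tv_j})$ (said to come from the edges $u_iv_t$, $u_tv_j$). $\phi_2''$ is the conjunction of those clauses of $\phi_2$ coming from a pair of edges both of which are committed in $H$. -}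

module Defs where

open import Level using (0ℓ)
open import Data.Nat using (ℕ)
open import Data.Fin using (Fin)
open import Data.Bool using (Bool; true; false; not)
open import Data.Sum using (_⊎_; inj₁; inj₂)
open import Data.Product using (_×_; _,_; ∃; ∃-syntax; Σ)
open import Data.Empty using (⊥)
open import Relation.Nullary using (¬_)
open import Relation.Binary using (Rel)
open import Relation.Binary.PropositionalEquality using (_≡_; _≢_)
open import Relation.Binary.Construct.Closure.ReflexiveTransitive using (Star)

W : ℕ → Set
W n = Fin n ⊎ Fin n

u : ∀ {n} → Fin n → W n
u = inj₁

v : ∀ {n} → Fin n → W n
v = inj₂

-- Adjacency of H (edge set E_H = Ẽ ∪ {vv' : v ≠ v'}), symmetric by construction.
Adj : ∀ {n} → Rel (Fin n) 0ℓ → W n → W n → Set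
Adj _<P_ (inj₁ i) (inj₁ i') = ⊥
Adj _<P_ (inj₁ i) (inj₂ j)  = ¬ (i <P j)
Adj _<P_ (inj₂ j) (inj₁ i)  = ¬ (i <P j)
Adj _<P_ (inj₂ j) (inj₂ j') = j ≢ j'

-- An (oriented representative of an) edge/pair of vertices.
Pair : ℕ → Set
Pair n = W n × W n

module Setting {n : ℕ} (_<P_ : Rel (Fin n) 0ℓ) where

  E : W n → W n → Set
  E = Adj _<P_

  IsEdge : Pair n → Set
  IsEdge (a , b) = E a b

  Conf : W n → W n → W n → W n → Set
  Conf a b c d =
    E a b × E c d ×
    a ≢ b × a ≢ c × a ≢ d × b ≢ c × b ≢ d × c ≢ d ×
    ¬ E a d × ¬ E b c

  Conflict : Pair n → Pair n → Set
  Conflict (a , b) (c , d) =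
    Conf a b c d ⊎ Conf b a c d ⊎ Conf a b d c ⊎ Conf b a d c

  Committed : Pair n → Set
  Committed e = IsEdge e × ∃[ f ] Conflict e f

  -- One step in H*: a conflict, or passing between the two orientations
  -- of the same (unordered) edge.
  data Step : Pair n → Pair n → Set where
    conf : ∀ {e f} → Conflict e f → Step e f
    flip : ∀ {a b} → E a b → Step (a , b) (b , a)

  SameComp : Pair n → Pair n → Set
  SameComp = Star Step

  -- χ₀ : colouring of edges, true = red, false = blue.
  Colouring : Set
  Colouring = W n → W n → Bool

  ProperColouring : Colouring → Set
  ProperColouring χ =
    (∀ a b → E a b → χ a b ≡ χ b a) ×
    (∀ a b c d → Conflict (a , b) (c , d) → χ a b ≢ χ c d)

  module WithColouring (χ : Colouring) where

    Lit : Set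
    Lit = Pair n × Bool

    pos : Pair n → Lit
    pos e = e , true

    neg : Pair n → Lit
    neg e = e , false

    -- polarity of the literal with respect to the component variable x_i
    -- (true = x_i, false = ¬ x_i); ℓ_e = x_i iff e is red.
    sign : Lit → Bool
    sign ((a , b) , true)  = χ a b
    sign ((a , b) , false) = not (χ a b)

    _≈L_ : Lit → Lit → Set
    (e , p) ≈L (f , q) = SameComp e f × sign (e , p) ≡ sign (f , q)

    IsNegOf : Pair n → Pair n → Set
    IsNegOf e f = (e , true) ≈L (f , false)

    ClauseEq : Lit → Lit → Lit → Lit → Set
    ClauseEq l₁ l₂ m₁ m₂ = (l₁ ≈L m₁ × l₂ ≈L m₂) ⊎ (l₁ ≈L m₂ × l₂ ≈L m₁)

    -- E' = E_H ∖ E₀ restricted to U×V pairs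
    E' : Fin n → Fin n → Set
    E' i j = E (u i) (v j) × i ≢ j

    InPhi2'' : Lit → Lit → Set
    InPhi2'' l₁ l₂ =
      ∃[ i ] ∃[ j ] ∃[ t ]
        ¬ E' i j × E' i t × E' t j ×
        Committed (u i , v t) × Committed (u t , v j) ×
        ClauseEq (pos (u i , v t)) (pos (u t , v j)) l₁ l₂

  AC6 : W n → W n → W n → W n → W n → W n → Set
  AC6 w₁ w₂ w₃ w₄ w₅ w₆ =
    w₁ ≢ w₂ × w₂ ≢ w₃ × w₃ ≢ w₄ × w₄ ≢ w₅ × w₅ ≢ w₆ × w₆ ≢ w₁ ×
    E w₂ w₃ × E w₄ w₅ × E w₆ w₁ ×
    ¬ E w₁ w₂ × ¬ E w₃ w₄ × ¬ E w₅ w₆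

-- All edges of H are U–V edges or lie in the clique V, so an AC₆ consists of U–V edges
-- u_{p₁}v_{q₁}, u_{p₂}v_{q₂}, u_{p₃}v_{q₃} with non-edges u_{p₁}v_{q₂}, u_{p₂}v_{q₃}, u_{p₃}v_{q₁}, and two
-- U–V edges u_a v_b, u_c v_d conflict as soon as u_a v_d and u_c v_b are non-edges.  If no two
-- literals of the AC₆ are negations of each other, the chords u_{p₂}v_{q₁}, u_{p₃}v_{q₂}, u_{p₁}v_{q₃}
-- are edges, and a conflict partner of u_{p₁}v_{q₁} together with two of these chords is again such an
-- AC₆, with every literal negated and the roles of e₂ and e₃ exchanged.  Hence every edge in the
-- component of e₁ in H* is the first edge of an AC₆ whose literals are those of e₁, e₂, e₃ up to one
-- common sign.  For the φ₂''-clause (ℓ_e ∨ ℓ_{e₁}) this puts the e₁-side edge into such an AC₆ with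
-- the sign positive; since the e-side edge is committed and ℓ_e ≠ ¬ℓ_{e₁}, a case analysis in which
-- every alternative yields two opposite literals of the AC₆ shows that the clause can be moved along a
-- chord, giving a clause (ℓ_e ∨ ¬ℓ_{e₂}) or (ℓ_e ∨ ¬ℓ_{e₃}).
module Submission where

open import Defs
open import Level using (0ℓ)
open import Data.Nat using (ℕ)
open import Data.Fin using (Fin)
open import Data.Sum using (_⊎_)
open import Data.Product using (_×_; _,_)
open import Relation.Nullary using (¬_)
open import Relation.Binary using (Rel; IsStrictPartialOrder)
open import Relation.Binary.PropositionalEquality using (_≡_)

open import Data.Bool using (Bool; true; false; not)
open import Data.Bool.Properties using (not-involutive; ¬-not; not-¬)
open import Data.Empty using (⊥; ⊥-elim)
open import Data.Fin.Properties using (_≟_)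
open import Data.Product using (proj₁; proj₂; swap)
open import Data.Sum using (inj₁; inj₂)
open import Function using (_∘_)
open import Relation.Nullary using (yes; no)
open import Relation.Binary.PropositionalEquality using (_≢_; refl; sym; trans; cong; subst; ≢-sym)
open import Relation.Binary.Construct.Closure.ReflexiveTransitive using (ε; _◅_; _◅◅_; reverse)

module InducedGraph {n : ℕ} (_<P_ : Rel (Fin n) 0ℓ) (isSPO : IsStrictPartialOrder _≡_ _<P_) where
  open Setting _<P_
  open IsStrictPartialOrder isSPO using () renaming (trans to <-trans)

  uv : Fin n → Fin n → Pair n
  uv i j = u i , v j

  Edge : Fin n → Fin n → Set
  Edge i j = E (u i) (v j)

  -- i ≺ j unfolds to ¬ ¬ (i <P j).
  infix 4 _≺_
  _≺_ : Fin n → Fin n → Set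
  i ≺ j = ¬ Edge i j

  ≺-trans : ∀ {i j k} → i ≺ j → j ≺ k → i ≺ k
  ≺-trans i≺j j≺k ¬i<k = i≺j λ i<j → j≺k λ j<k → ¬i<k (<-trans i<j j<k)

  ¬≺⇒edge : ∀ {i j} → ¬ i ≺ j → Edge i j
  ¬≺⇒edge ¬≺ i<j = ¬≺ λ i≮j → i≮j i<j

  ≺-or-edge : ∀ {i j} → (i ≺ j → ⊥) → (Edge i j → ⊥) → ⊥
  ≺-or-edge ¬≺ ¬edge = ¬≺ ¬edge

  E-sym : ∀ {a b} → E a b → E b a
  E-sym {inj₁ _} {inj₂ _} ab = ab
  E-sym {inj₂ _} {inj₁ _} ab = ab
  E-sym {inj₂ _} {inj₂ _} ab = ab ∘ sym

  Conf-swap : ∀ {a b c d} → Conf a b c d → Conf b a d c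
  Conf-swap (ab , cd , a≢b , a≢c , a≢d , b≢c , b≢d , c≢d , ¬ad , ¬bc) =
    E-sym ab , E-sym cd , ≢-sym a≢b , b≢d , b≢c , a≢d , a≢c , ≢-sym c≢d , ¬bc , ¬ad

  Conf-sym : ∀ {a b c d} → Conf a b c d → Conf c d a b
  Conf-sym (ab , cd , a≢b , a≢c , a≢d , b≢c , b≢d , c≢d , ¬ad , ¬bc) =
    cd , ab , c≢d , ≢-sym a≢c , ≢-sym b≢c , ≢-sym a≢d , ≢-sym b≢d , a≢b , ¬bc ∘ E-sym , ¬ad ∘ E-sym

  Conflict-sym : ∀ {e f} → Conflict e f → Conflict f e
  Conflict-sym (inj₁ k)               = inj₁ (Conf-sym k)
  Conflict-sym (inj₂ (inj₁ k))        = inj₂ (inj₂ (inj₁ (Conf-sym k)))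
  Conflict-sym (inj₂ (inj₂ (inj₁ k))) = inj₂ (inj₁ (Conf-sym k))
  Conflict-sym (inj₂ (inj₂ (inj₂ k))) = inj₂ (inj₂ (inj₂ (Conf-sym k)))

  Conflict-swapˡ : ∀ {a b f} → Conflict (a , b) f → Conflict (b , a) f
  Conflict-swapˡ (inj₁ k)               = inj₂ (inj₁ k)
  Conflict-swapˡ (inj₂ (inj₁ k))        = inj₁ k
  Conflict-swapˡ (inj₂ (inj₂ (inj₁ k))) = inj₂ (inj₂ (inj₂ k))
  Conflict-swapˡ (inj₂ (inj₂ (inj₂ k))) = inj₂ (inj₂ (inj₁ k))

  Step-sym : ∀ {e f} → Step e f → Step f e
  Step-sym (conf k)  = conf (Conflict-sym k)
  Step-sym (flip ab) = flip (E-sym ab)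

  SameComp-sym : ∀ {e f} → SameComp e f → SameComp f e
  SameComp-sym = reverse Step-sym

  ≺-conflict : ∀ {a b c d} → a ≺ d → c ≺ b → Edge a b → Edge c d → Conflict (uv a b) (uv c d)
  ≺-conflict {a} {b} {c} {d} a≺d c≺b ab cd =
    inj₁ (ab , cd , (λ ()) , ua≢uc , (λ ()) , (λ ()) , vb≢vd , (λ ()) , a≺d , c≺b)
    where
    ua≢uc : u a ≢ u c
    ua≢uc refl = c≺b ab
    vb≢vd : v b ≢ v d
    vb≢vd refl = c≺b cd

  Orientation : Pair n → Pair n → Set
  Orientation y e = y ≡ e ⊎ y ≡ swap e

  Orientation-swap : ∀ {a b e} → Orientation (a , b) e → Orientation (b , a) e
  Orientation-swap (inj₁ eq) = inj₂ (cong swap eq)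
  Orientation-swap (inj₂ eq) = inj₁ (cong swap eq)

  record ConflictPartner (p q : Fin n) (z : Pair n) : Set where
    constructor partner
    field
      x y         : Fin n
      orientation : Orientation z (uv x y)
      p≺y         : p ≺ y
      x≺q         : x ≺ q
      edge        : Edge x y

  ConflictPartner-swap : ∀ {p q c d} → ConflictPartner p q (d , c) → ConflictPartner p q (c , d)
  ConflictPartner-swap (partner x y o p≺y x≺q xy) = partner x y (Orientation-swap o) p≺y x≺q xy

  Conf-partner : ∀ {p q} c d → Conf (u p) (v q) c d → ConflictPartner p q (c , d)
  Conf-partner (inj₁ _) (inj₁ _) (_ , () , _)
  Conf-partner (inj₁ x) (inj₂ y) (_ , xy , _ , _ , _ , _ , _ , _ , p≺y , x≺q) =
    partner x y (inj₁ refl) p≺y x≺q xy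
  Conf-partner (inj₂ _) _ (_ , _ , _ , _ , _ , vq≢c , _ , _ , _ , ¬vq-c) = ⊥-elim (¬vq-c (vq≢c ∘ cong v))

  uv-conflict-partner : ∀ {p q z} → Conflict (uv p q) z → ConflictPartner p q z
  uv-conflict-partner {z = c , d} (inj₁ k)               = Conf-partner c d k
  uv-conflict-partner {z = c , d} (inj₂ (inj₁ k))        = ConflictPartner-swap (Conf-partner d c (Conf-swap k))
  uv-conflict-partner {z = c , d} (inj₂ (inj₂ (inj₁ k))) = ConflictPartner-swap (Conf-partner d c k)
  uv-conflict-partner {z = c , d} (inj₂ (inj₂ (inj₂ k))) = Conf-partner c d (Conf-swap k)

  conflict-partner : ∀ {y p q z} → Orientation y (uv p q) → Conflict y z → ConflictPartner p q z
  conflict-partner (inj₁ refl) k = uv-conflict-partner k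
  conflict-partner (inj₂ refl) k = uv-conflict-partner (Conflict-swapˡ k)

  -- The AC₆ (v_{q₂}, u_{p₁}, v_{q₁}, u_{p₃}, v_{q₃}, u_{p₂}), in the vertex order of AC6.
  record UVAC6 : Set where
    field
      p₁ q₁ p₂ q₂ p₃ q₃ : Fin n
      p₁≺q₂ : p₁ ≺ q₂
      p₂≺q₃ : p₂ ≺ q₃
      p₃≺q₁ : p₃ ≺ q₁
      edge₁ : Edge p₁ q₁
      edge₂ : Edge p₂ q₂
      edge₃ : Edge p₃ q₃

    uv₁ uv₂ uv₃ : Pair n
    uv₁ = uv p₁ q₁
    uv₂ = uv p₂ q₂
    uv₃ = uv p₃ q₃

  module Literals (χ : Colouring) (proper : ProperColouring χ) where
    open WithColouring χ

    -- ≈L computes to a product, which hides the literals from unification; this wrapper keeps them.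
    infix 4 _∼_
    record _∼_ (l m : Lit) : Set where
      constructor wrap
      field unwrap : l ≈L m
    open _∼_ public

    ∼-refl : ∀ {l} → l ∼ l
    ∼-refl = wrap (ε , refl)

    ∼-sym : ∀ {l m} → l ∼ m → m ∼ l
    ∼-sym (wrap (path , s)) = wrap (SameComp-sym path , sym s)

    infixr 5 _⨾_
    _⨾_ : ∀ {l m k} → l ∼ m → m ∼ k → l ∼ k
    wrap (path , s) ⨾ wrap (path′ , s′) = wrap (path ◅◅ path′ , trans s s′)

    sign-not : ∀ e p → sign (e , not p) ≡ not (sign (e , p))
    sign-not e true  = refl
    sign-not e false = sym (not-involutive _)

    ∼-not : ∀ {e f p q} → (e , p) ∼ (f , q) → (e , not p) ∼ (f , not q)
    ∼-not {e} {f} {p} {q} (wrap (path , s)) =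
      wrap (path , trans (sign-not e p) (trans (cong not s) (sym (sign-not f q))))

    Opposite : Pair n → Pair n → Set
    Opposite e f = (e , true) ∼ (f , false)

    Opposite-sym : ∀ {e f} → Opposite e f → Opposite f e
    Opposite-sym = ∼-not ∘ ∼-sym

    ¬Opposite-self : ∀ {e} → ¬ Opposite e e
    ¬Opposite-self (wrap (_ , s)) = not-¬ refl s

    conflict⇒opposite : ∀ {e f} → Conflict e f → ∀ {p} → (e , p) ∼ (f , not p)
    conflict⇒opposite {a , b} {c , d} k {true}  = wrap (conf k ◅ ε , ¬-not (proj₂ proper a b c d k))
    conflict⇒opposite {a , b} {c , d} k {false} =
      wrap (conf k ◅ ε , sym (¬-not (≢-sym (proj₂ proper a b c d k))))

    flip-same : ∀ {a b} → E a b → ∀ {p} → ((a , b) , p) ∼ ((b , a) , p)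
    flip-same {a} {b} ab {true}  = wrap (flip ab ◅ ε , proj₁ proper a b ab)
    flip-same {a} {b} ab {false} = wrap (flip ab ◅ ε , cong not (proj₁ proper a b ab))

    opposite : ∀ {a b c d} → a ≺ d → c ≺ b → Edge a b → Edge c d → ∀ {p} → (uv a b , p) ∼ (uv c d , not p)
    opposite a≺d c≺b ab cd = conflict⇒opposite (≺-conflict a≺d c≺b ab cd)

    opposite-transfer : ∀ {a b e f s} → (a , true) ∼ (e , s) → (b , true) ∼ (f , s) → Opposite a b → Opposite e f
    opposite-transfer {s = true}  ae bf ab = ∼-sym ae ⨾ ab ⨾ ∼-not bf
    opposite-transfer {s = false} ae bf ab = ∼-not (∼-sym ae ⨾ ab ⨾ ∼-not bf)

    record HasClausesInPhi1 (c : UVAC6) : Set where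
      field
        ¬opp₁₂ : ¬ Opposite (UVAC6.uv₁ c) (UVAC6.uv₂ c)
        ¬opp₁₃ : ¬ Opposite (UVAC6.uv₁ c) (UVAC6.uv₃ c)
        ¬opp₂₃ : ¬ Opposite (UVAC6.uv₂ c) (UVAC6.uv₃ c)

    module Cycle (c : UVAC6) (apart : HasClausesInPhi1 c) where
      open UVAC6 c public
      open HasClausesInPhi1 apart

      chord₂₁ : Edge p₂ q₁
      chord₂₁ = ¬≺⇒edge λ p₂≺q₁ → ¬opp₁₂ (opposite p₁≺q₂ p₂≺q₁ edge₁ edge₂)

      chord₃₂ : Edge p₃ q₂
      chord₃₂ = ¬≺⇒edge λ p₃≺q₂ → ¬opp₂₃ (opposite p₂≺q₃ p₃≺q₂ edge₂ edge₃)

      chord₁₃ : Edge p₁ q₃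
      chord₁₃ = ¬≺⇒edge λ p₁≺q₃ → ¬opp₁₃ (Opposite-sym (opposite p₃≺q₁ p₁≺q₃ edge₃ edge₁))

      chord₂₁-opposite : ∀ {p} → (uv p₂ q₁ , p) ∼ (uv₃ , not p)
      chord₂₁-opposite = opposite p₂≺q₃ p₃≺q₁ chord₂₁ edge₃

      chord₁₃-opposite : ∀ {p} → (uv p₁ q₃ , p) ∼ (uv₂ , not p)
      chord₁₃-opposite = opposite p₁≺q₂ p₂≺q₃ chord₁₃ edge₂

      E′₂₁ : E' p₂ q₁
      E′₂₁ = chord₂₁ , λ p₂≡q₁ → ≺-trans (subst (p₃ ≺_) (sym p₂≡q₁) p₃≺q₁) p₂≺q₃ edge₃

      E′₁₃ : E' p₁ q₃
      E′₁₃ = chord₁₃ , λ p₁≡q₃ → ≺-trans (subst (p₂ ≺_) (sym p₁≡q₃) p₂≺q₃) p₁≺q₂ edge₂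

      committed₂₁ : Committed (uv p₂ q₁)
      committed₂₁ = chord₂₁ , uv₃ , ≺-conflict p₂≺q₃ p₃≺q₁ chord₂₁ edge₃

      committed₁₃ : Committed (uv p₁ q₃)
      committed₁₃ = chord₁₃ , uv₂ , ≺-conflict p₁≺q₂ p₂≺q₃ chord₁₃ edge₂

      rotate : ∀ {x w} → p₁ ≺ w → x ≺ q₁ → Edge x w → UVAC6
      rotate {x} {w} p₁≺w x≺q₁ xw = record
        { p₁ = x ; q₁ = w ; p₂ = p₂ ; q₂ = q₁ ; p₃ = p₁ ; q₃ = q₃
        ; p₁≺q₂ = x≺q₁ ; p₂≺q₃ = p₂≺q₃ ; p₃≺q₁ = p₁≺w
        ; edge₁ = xw ; edge₂ = chord₂₁ ; edge₃ = chord₁₃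
        }

      ¬edge-into-q₃ : ∀ {x} → x ≺ q₁ → x ≺ q₂ → ¬ Edge x q₃
      ¬edge-into-q₃ x≺q₁ x≺q₂ xq₃ =
        ¬opp₂₃ (opposite p₂≺q₃ x≺q₂ edge₂ xq₃ ⨾ opposite x≺q₁ p₂≺q₃ xq₃ chord₂₁ ⨾ chord₂₁-opposite)

      ¬edge-out-of-p₂ : ∀ {y} → p₃ ≺ y → p₁ ≺ y → ¬ Edge p₂ y
      ¬edge-out-of-p₂ p₃≺y p₁≺y p₂y =
        ¬opp₂₃ (∼-sym chord₁₃-opposite ⨾ opposite p₁≺y p₂≺q₃ chord₁₃ p₂y ⨾ opposite p₂≺q₃ p₃≺y p₂y edge₃)

      ¬edge-via-p₃ : ∀ {i x y} → Edge i p₁ → ¬ Opposite (uv i p₁) uv₁ →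
                     x ≺ p₁ → i ≺ y → p₃ ≺ y → ¬ Edge x y
      ¬edge-via-p₃ ip₁ ¬opp x≺p₁ i≺y p₃≺y xy = ¬opp
        (opposite i≺y x≺p₁ ip₁ xy ⨾ opposite (≺-trans x≺p₁ p₁≺q₂) p₃≺y xy chord₃₂
          ⨾ opposite p₃≺q₁ p₁≺q₂ chord₃₂ edge₁)

      through-p₁⇒≺q₃ : ∀ {i} → ¬ E' i q₁ → Edge i p₁ → Committed (uv i p₁) →
                       ¬ Opposite (uv i p₁) uv₁ → i ≺ q₃
      through-p₁⇒≺q₃ {i} i≼q₁ ip₁ (_ , _ , k) ¬opp iq₃ with uv-conflict-partner k | i ≟ q₁
      ... | partner a b _ i≺b a≺p₁ ab | yes refl =
        ¬edge-via-p₃ ip₁ ¬opp a≺p₁ i≺b (≺-trans p₃≺q₁ i≺b) ab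
      ... | partner a b _ i≺b a≺p₁ ab | no i≢q₁ =
        ≺-or-edge (λ i≺q₂ → ¬edge-into-q₃ i≺q₁ i≺q₂ iq₃) λ iq₂ →
        ≺-or-edge (λ a≺q₃ → ¬opp₁₃
          (opposite p₁≺q₂ i≺q₁ edge₁ iq₂ ⨾ opposite i≺b (≺-trans a≺p₁ p₁≺q₂) iq₂ ab
            ⨾ opposite a≺q₃ i≺b ab iq₃ ⨾ opposite i≺q₁ p₂≺q₃ iq₃ chord₂₁ ⨾ chord₂₁-opposite))
          λ aq₃ → ¬edge-into-q₃ a≺q₁ (≺-trans a≺p₁ p₁≺q₂) aq₃
        where
        i≺q₁ : i ≺ q₁
        i≺q₁ iq₁ = i≼q₁ (iq₁ , i≢q₁)
        a≺q₁ : a ≺ q₁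
        a≺q₁ = ¬edge-via-p₃ ip₁ ¬opp a≺p₁ i≺q₁ p₃≺q₁

      ¬edge-via-q₂ : ∀ {j x y} → Edge q₁ j → ¬ Opposite (uv q₁ j) uv₁ →
                     q₁ ≺ y → x ≺ j → x ≺ q₂ → ¬ Edge x y
      ¬edge-via-q₂ q₁j ¬opp q₁≺y x≺j x≺q₂ xy = ¬opp
        (opposite q₁≺y x≺j q₁j xy ⨾ opposite x≺q₂ (≺-trans p₃≺q₁ q₁≺y) xy chord₃₂
          ⨾ opposite p₃≺q₁ p₁≺q₂ chord₃₂ edge₁)

      through-q₁⇒p₂≺ : ∀ {j} → ¬ E' p₁ j → Edge q₁ j → Committed (uv q₁ j) →
                       ¬ Opposite (uv q₁ j) uv₁ → p₂ ≺ j
      through-q₁⇒p₂≺ {j} p₁≼j q₁j (_ , _ , k) ¬opp p₂j with uv-conflict-partner k | p₁ ≟ j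
      ... | partner a b _ q₁≺b a≺j ab | yes refl =
        ¬edge-via-q₂ q₁j ¬opp q₁≺b a≺j (≺-trans a≺j p₁≺q₂) ab
      ... | partner a b _ q₁≺b a≺j ab | no p₁≢j =
        ≺-or-edge (λ p₃≺j → ¬edge-out-of-p₂ p₃≺j p₁≺j p₂j) λ p₃j →
        ≺-or-edge (λ p₂≺b → ¬opp₁₂
          (opposite p₁≺j p₃≺q₁ edge₁ p₃j ⨾ opposite (≺-trans p₃≺q₁ q₁≺b) a≺j p₃j ab
            ⨾ opposite a≺j p₂≺b ab p₂j ⨾ opposite p₂≺q₃ p₁≺j p₂j chord₁₃ ⨾ chord₁₃-opposite))
          λ p₂b → ¬edge-out-of-p₂ (≺-trans p₃≺q₁ q₁≺b) p₁≺b p₂b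
        where
        p₁≺j : p₁ ≺ j
        p₁≺j p₁j = p₁≼j (p₁j , p₁≢j)
        p₁≺b : p₁ ≺ b
        p₁≺b = ¬edge-via-q₂ q₁j ¬opp q₁≺b p₁≺j p₁≺q₂

      clause-through-p₁ : ∀ {e i K} → ¬ E' i q₁ → E' i p₁ → Committed (uv i p₁) → (uv i p₁ , true) ∼ (e , true) →
                          ¬ Opposite (uv i p₁) uv₁ → (uv₂ , true) ∼ (K , true) → InPhi2'' (pos e) (neg K)
      clause-through-p₁ {i = i} i≼q₁ E′ip₁ committed ip₁∼e ¬opp uv₂∼K =
        i , q₃ , p₁ , i≼q₃ , E′ip₁ , E′₁₃ , committed , committed₁₃ ,
        inj₁ (unwrap ip₁∼e , unwrap (chord₁₃-opposite ⨾ ∼-not uv₂∼K))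
        where
        i≼q₃ : ¬ E' i q₃
        i≼q₃ = through-p₁⇒≺q₃ i≼q₁ (proj₁ E′ip₁) committed ¬opp ∘ proj₁

      clause-through-q₁ : ∀ {e j K} → ¬ E' p₁ j → E' q₁ j → Committed (uv q₁ j) → (uv q₁ j , true) ∼ (e , true) →
                          ¬ Opposite (uv q₁ j) uv₁ → (uv₃ , true) ∼ (K , true) → InPhi2'' (pos e) (neg K)
      clause-through-q₁ {j = j} p₁≼j E′q₁j committed q₁j∼e ¬opp uv₃∼K =
        p₂ , j , q₁ , p₂≼j , E′₂₁ , E′q₁j , committed₂₁ , committed ,
        inj₂ (unwrap (chord₂₁-opposite ⨾ ∼-not uv₃∼K) , unwrap q₁j∼e)
        where
        p₂≼j : ¬ E' p₂ j
        p₂≼j = through-q₁⇒p₂≺ p₁≼j (proj₁ E′q₁j) committed ¬opp ∘ proj₁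

    Matches : (e₂ e₃ a b : Pair n) → Bool → Set
    Matches e₂ e₃ a b s = ((a , true) ∼ (e₂ , s) × (b , true) ∼ (e₃ , s))
                        ⊎ ((a , true) ∼ (e₃ , s) × (b , true) ∼ (e₂ , s))

    Matches-opposite : ∀ {e₂ e₃ a b a′ b′ s} → Matches e₂ e₃ a b s →
                       Opposite a′ b → Opposite b′ a → Matches e₂ e₃ a′ b′ (not s)
    Matches-opposite (inj₁ (a₂ , b₃)) a′b b′a = inj₂ (a′b ⨾ ∼-not b₃ , b′a ⨾ ∼-not a₂)
    Matches-opposite (inj₂ (a₃ , b₂)) a′b b′a = inj₁ (a′b ⨾ ∼-not b₂ , b′a ⨾ ∼-not a₃)

    Matches-first : ∀ {e₂ e₃ a b s} {P : Pair n → Set} → Matches e₂ e₃ a b s →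
                    (∀ {K} → (a , true) ∼ (K , s) → P K) → P e₂ ⊎ P e₃
    Matches-first (inj₁ (a₂ , _)) f = inj₁ (f a₂)
    Matches-first (inj₂ (a₃ , _)) f = inj₂ (f a₃)

    Matches-second : ∀ {e₂ e₃ a b s} {P : Pair n → Set} → Matches e₂ e₃ a b s →
                     (∀ {K} → (b , true) ∼ (K , s) → P K) → P e₂ ⊎ P e₃
    Matches-second (inj₁ (_ , b₃)) f = inj₂ (f b₃)
    Matches-second (inj₂ (_ , b₂)) f = inj₁ (f b₂)

    record Mirror (e₁ e₂ e₃ y : Pair n) : Set where
      field
        cycle       : UVAC6
        orientation : Orientation y (UVAC6.uv₁ cycle)
        polarity    : Bool
        first       : (UVAC6.uv₁ cycle , true) ∼ (e₁ , polarity)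
        others      : Matches e₂ e₃ (UVAC6.uv₂ cycle) (UVAC6.uv₃ cycle) polarity

    AC6⇒Mirror : ∀ {w₁ w₂ w₃ w₄ w₅ w₆} → AC6 w₁ w₂ w₃ w₄ w₅ w₆ → Mirror (w₂ , w₃) (w₄ , w₅) (w₆ , w₁) (w₂ , w₃)
    AC6⇒Mirror {inj₁ a} {inj₂ b} {inj₁ c} {inj₂ d} {inj₁ e} {inj₂ f}
               (_ , _ , _ , _ , _ , _ , cb , ed , af , a≺b , c≺d , e≺f) = record
      { cycle = record { p₁ = c ; q₁ = b ; p₂ = e ; q₂ = d ; p₃ = a ; q₃ = f
                       ; p₁≺q₂ = c≺d ; p₂≺q₃ = e≺f ; p₃≺q₁ = a≺b
                       ; edge₁ = cb ; edge₂ = ed ; edge₃ = af }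
      ; orientation = inj₂ refl
      ; polarity = true
      ; first = flip-same cb
      ; others = inj₁ (flip-same ed , flip-same af)
      }
    AC6⇒Mirror {inj₂ a} {inj₁ b} {inj₂ c} {inj₁ d} {inj₂ e} {inj₁ f}
               (_ , _ , _ , _ , _ , _ , bc , de , fa , b≺a , d≺c , f≺e) = record
      { cycle = record { p₁ = b ; q₁ = c ; p₂ = f ; q₂ = a ; p₃ = d ; q₃ = e
                       ; p₁≺q₂ = b≺a ; p₂≺q₃ = f≺e ; p₃≺q₁ = d≺c
                       ; edge₁ = bc ; edge₂ = fa ; edge₃ = de }
      ; orientation = inj₁ refl
      ; polarity = true
      ; first = ∼-refl
      ; others = inj₂ (∼-refl , ∼-refl)
      }
    AC6⇒Mirror {w₂ = inj₁ _} {inj₁ _} (_ , _ , _ , _ , _ , _ , () , _)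
    AC6⇒Mirror {w₄ = inj₁ _} {inj₁ _} (_ , _ , _ , _ , _ , _ , _ , () , _)
    AC6⇒Mirror {inj₁ _} {w₆ = inj₁ _} (_ , _ , _ , _ , _ , _ , _ , _ , () , _)
    AC6⇒Mirror {inj₂ _} {inj₂ _} (w₁≢w₂ , _ , _ , _ , _ , _ , _ , _ , _ , ¬w₁w₂ , _ , _) =
      ⊥-elim (¬w₁w₂ (w₁≢w₂ ∘ cong v))
    AC6⇒Mirror {w₃ = inj₂ _} {inj₂ _} (_ , _ , w₃≢w₄ , _ , _ , _ , _ , _ , _ , _ , ¬w₃w₄ , _) =
      ⊥-elim (¬w₃w₄ (w₃≢w₄ ∘ cong v))
    AC6⇒Mirror {w₅ = inj₂ _} {inj₂ _} (_ , _ , _ , _ , w₅≢w₆ , _ , _ , _ , _ , _ , _ , ¬w₅w₆) =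
      ⊥-elim (¬w₅w₆ (w₅≢w₆ ∘ cong v))

    module Component (e₁ e₂ e₃ : Pair n)
                     (¬opp₁₂ : ¬ Opposite e₁ e₂) (¬opp₁₃ : ¬ Opposite e₁ e₃) (¬opp₂₃ : ¬ Opposite e₂ e₃) where

      Mirror⇒HasClausesInPhi1 : ∀ {y} (m : Mirror e₁ e₂ e₃ y) → HasClausesInPhi1 (Mirror.cycle m)
      Mirror⇒HasClausesInPhi1 record { first = first ; others = inj₁ (c₂ , c₃) } = record
        { ¬opp₁₂ = ¬opp₁₂ ∘ opposite-transfer first c₂
        ; ¬opp₁₃ = ¬opp₁₃ ∘ opposite-transfer first c₃
        ; ¬opp₂₃ = ¬opp₂₃ ∘ opposite-transfer c₂ c₃
        }
      Mirror⇒HasClausesInPhi1 record { first = first ; others = inj₂ (c₂ , c₃) } = record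
        { ¬opp₁₂ = ¬opp₁₃ ∘ opposite-transfer first c₂
        ; ¬opp₁₃ = ¬opp₁₂ ∘ opposite-transfer first c₃
        ; ¬opp₂₃ = ¬opp₂₃ ∘ Opposite-sym ∘ opposite-transfer c₂ c₃
        }

      Mirror-conflict : ∀ {y z} → Mirror e₁ e₂ e₃ y → Conflict y z → Mirror e₁ e₂ e₃ z
      Mirror-conflict m k with conflict-partner (Mirror.orientation m) k
      ... | partner x w z-orientation p₁≺w x≺q₁ xw = record
        { cycle = rotate p₁≺w x≺q₁ xw
        ; orientation = z-orientation
        ; polarity = not polarity
        ; first = opposite x≺q₁ p₁≺w xw edge₁ ⨾ ∼-not first
        ; others = Matches-opposite others chord₂₁-opposite chord₁₃-opposite
        }
        where
        open Mirror m
        open Cycle cycle (Mirror⇒HasClausesInPhi1 m)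

      Mirror-step : ∀ {y z} → Mirror e₁ e₂ e₃ y → Step y z → Mirror e₁ e₂ e₃ z
      Mirror-step m (conf k) = Mirror-conflict m k
      Mirror-step m (flip _) = record
        { cycle = cycle ; orientation = Orientation-swap orientation
        ; polarity = polarity ; first = first ; others = others }
        where open Mirror m

      Mirror-component : ∀ {y} → Mirror e₁ e₂ e₃ e₁ → SameComp y e₁ → Mirror e₁ e₂ e₃ y
      Mirror-component m path = go (SameComp-sym path) m
        where
        go : ∀ {y z} → SameComp y z → Mirror e₁ e₂ e₃ y → Mirror e₁ e₂ e₃ z
        go ε        m = m
        go (s ◅ ss) m = go ss (Mirror-step m s)

      Conclusion : Pair n → Set
      Conclusion e = InPhi2'' (pos e) (neg e₂) ⊎ InPhi2'' (pos e) (neg e₃)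

      conclusion-e₁-right : ∀ {e i t j} → Mirror e₁ e₂ e₃ (uv t j) → (uv t j , true) ∼ (e₁ , true) →
                            ¬ E' i j → E' i t → Committed (uv i t) → (uv i t , true) ∼ (e , true) →
                            ¬ Opposite e e₁ → Conclusion e
      conclusion-e₁-right record { orientation = inj₂ () }
      conclusion-e₁-right record { orientation = inj₁ refl ; polarity = false ; first = first } tj∼e₁ _ _ _ _ _ =
        ⊥-elim (¬Opposite-self (∼-sym tj∼e₁ ⨾ first))
      conclusion-e₁-right m@record { cycle = c ; orientation = inj₁ refl ; polarity = true ; first = first ; others = others }
                          _ i≼j E′it committed it∼e ¬opp =
        Matches-first others (clause-through-p₁ i≼j E′it committed it∼e λ o → ¬opp (∼-sym it∼e ⨾ o ⨾ ∼-not first))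
        where open Cycle c (Mirror⇒HasClausesInPhi1 m)

      conclusion-e₁-left : ∀ {e i t j} → Mirror e₁ e₂ e₃ (uv i t) → (uv i t , true) ∼ (e₁ , true) →
                           ¬ E' i j → E' t j → Committed (uv t j) → (uv t j , true) ∼ (e , true) →
                           ¬ Opposite e e₁ → Conclusion e
      conclusion-e₁-left record { orientation = inj₂ () }
      conclusion-e₁-left record { orientation = inj₁ refl ; polarity = false ; first = first } it∼e₁ _ _ _ _ _ =
        ⊥-elim (¬Opposite-self (∼-sym it∼e₁ ⨾ first))
      conclusion-e₁-left m@record { cycle = c ; orientation = inj₁ refl ; polarity = true ; first = first ; others = others }
                         _ i≼j E′tj committed tj∼e ¬opp =
        Matches-second others (clause-through-q₁ i≼j E′tj committed tj∼e λ o → ¬opp (∼-sym tj∼e ⨾ o ⨾ ∼-not first))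
        where open Cycle c (Mirror⇒HasClausesInPhi1 m)

lemma18 : (n : ℕ) (_<P_ : Rel (Fin n) 0ℓ) → IsStrictPartialOrder _≡_ _<P_ →
    (χ₀ : Setting.Colouring _<P_) → Setting.ProperColouring _<P_ χ₀ →
    (w₁ w₂ w₃ w₄ w₅ w₆ : W n) → Setting.AC6 _<P_ w₁ w₂ w₃ w₄ w₅ w₆ →
    let e₁ = (w₂ , w₃)
        e₂ = (w₄ , w₅)
        e₃ = (w₆ , w₁)
        open Setting _<P_
        open WithColouring χ₀
    in ¬ IsNegOf e₁ e₂ → ¬ IsNegOf e₁ e₃ → ¬ IsNegOf e₂ e₃ →
       (e : Pair n) → IsEdge e →
       InPhi2'' (pos e) (pos e₁) →
       ¬ (pos e ≈L neg e₁) →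
       InPhi2'' (pos e) (neg e₂) ⊎ InPhi2'' (pos e) (neg e₃)
lemma18 n _<P_ isSPO χ₀ proper w₁ w₂ w₃ w₄ w₅ w₆ ac ¬neg₁₂ ¬neg₁₃ ¬neg₂₃ e _
        (i , j , t , i≼j , E′it , E′tj , committed-it , committed-tj , clause≈) ¬neg = conclude clause≈
  where
  open Setting _<P_
  open WithColouring χ₀
  open InducedGraph _<P_ isSPO
  open Literals χ₀ proper
  open Component (w₂ , w₃) (w₄ , w₅) (w₆ , w₁) (¬neg₁₂ ∘ unwrap) (¬neg₁₃ ∘ unwrap) (¬neg₂₃ ∘ unwrap)

  mirror : ∀ {y} → (y , true) ∼ ((w₂ , w₃) , true) → Mirror (w₂ , w₃) (w₄ , w₅) (w₆ , w₁) y
  mirror y∼e₁ = Mirror-component (AC6⇒Mirror ac) (proj₁ (unwrap y∼e₁))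

  conclude : ClauseEq (pos (uv i t)) (pos (uv t j)) (pos e) (pos (w₂ , w₃)) → Conclusion e
  conclude (inj₁ (it≈e , tj≈e₁)) =
    conclusion-e₁-right (mirror (wrap tj≈e₁)) (wrap tj≈e₁) i≼j E′it committed-it (wrap it≈e) (¬neg ∘ unwrap)
  conclude (inj₂ (it≈e₁ , tj≈e)) =
    conclusion-e₁-left (mirror (wrap it≈e₁)) (wrap it≈e₁) i≼j E′tj committed-tj (wrap tj≈e) (¬neg ∘ unwrap)
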